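{- Let $1\le p\le k$ be integers and let $P_1(k,p)$ denote the probability that, for a string $t=t_1\cdots t_{k+1}$ chosen uniformly at random from $\{0,1,2,3\}^{k+1}$, either the first length-$p$ substring $t_1\cdots t_p$ or the last length-$p$ substring $t_{k-p+2}\cdots t_{k+1}$ is the unique minimum length-$p$ substring of $t$ (i.e. it is lexicographically strictly smaller than the length-$p$ substrings of $t$ starting at every other position). Then $P_1(k,p)\le \frac{p+1}{k+1}$.
   Context: Strings of equal length over the alphabet $\{0,1,2,3\}$ (ordered $0<1<2<3$) are compared lexicographically. Equivalently, $P_1(k,p)$ is the probability that the minimum $p$-substring of the last $k$-mer of a uniformly random string differs from that of the second-to-last $k$-mer. -}

module Defs where

open import Data.Nat using (ℕ; zero; suc; _+_; _*_; _∸_; _^_; _≤_; _<ᵇ_)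
open import Data.Fin using (Fin; toℕ)
open import Data.Bool using (Bool; true; false; _∧_; _∨_; if_then_else_)
open import Data.List using (List; []; _∷_; map; concatMap; take; drop; length; upTo; filter; applyUpTo; allFin)
open import Data.Bool using (T?)
open import Data.Nat using (_≡ᵇ_)

Letter : Set
Letter = Fin 4

allStrings : ℕ → List (List Letter)
allStrings zero = [] ∷ []
allStrings (suc n) = concatMap (λ a → map (a ∷_) (allStrings n)) (allFin 4)

allB : {A : Set} → (A → Bool) → List A → Bool
allB f [] = true
allB f (x ∷ xs) = f x ∧ allB f xs

_<lex_ : List Letter → List Letter → Bool
[] <lex [] = false
[] <lex (_ ∷ _) = true
(_ ∷ _) <lex [] = false
(a ∷ u) <lex (b ∷ v) =
  if toℕ a <ᵇ toℕ b then true
  else (if toℕ a ≡ᵇ toℕ b then u <lex v else false)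

-- Length-p substring of t starting at 0-indexed position i.
sub : ℕ → List Letter → ℕ → List Letter
sub p t i = take p (drop i t)

isUniqueMinAt : ℕ → ℕ → List Letter → ℕ → Bool
isUniqueMinAt n p t i =
  allB (λ j → if j ≡ᵇ i then true else sub p t i <lex sub p t j) (upTo (suc (n ∸ p)))

event : ℕ → ℕ → List Letter → Bool
event k p t = isUniqueMinAt (suc k) p t 0 ∨ isUniqueMinAt (suc k) p t (suc k ∸ p)

-- Number of strings in {0,1,2,3}^(k+1) satisfying the event;
-- P₁(k,p) = count k p / 4^(k+1).
count : ℕ → ℕ → ℕ
count k p = length (filter (λ t → T? (event k p t)) (allStrings (suc k)))

module Submission where

-- Let n = k + 1 and write E(t) ∈ {0,1} for the indicator of the event.
-- Rotating a string by one letter is a bijection of {0,1,2,3}^n, hence so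
-- is rotating by r letters, and for every r < n the number of strings t
-- with E(t) equals the number of strings u with E(rotate r u).  Summing
-- over r and exchanging the sums,
--     count · n = Σ_u Σ_{r<n} E(rotate r u).
-- For a fixed u, choose a position g where the cyclic length-p window of u
-- is minimal.  In the rotation by r this window reappears as an ordinary
-- window at some offset o; if that offset is neither the first position
-- nor among the last p positions, then neither end window can be the unique
-- minimum.  Only p + 1 rotations put the offset in those places, so the
-- inner sum is at most p + 1, and count · n ≤ (p + 1) · 4^n.

open import Defs
open import Data.Bool using (Bool; true; false; T; T?; if_then_else_)
open import Data.Bool.Properties using (T-∧; T-∨)
open import Data.Empty using (⊥-elim)
open import Data.Fin using (toℕ)
open import Data.Fin.Properties using (toℕ<n)
open import Data.List
  using (List; []; _∷_; _++_; _∷ʳ_; [_]; map; concatMap; take; drop; length; filter; upTo; applyUpTo; allFin)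
open import Data.List.Properties
  using (++-assoc; ++-identityʳ; length-++; length-++-≤ˡ; length-take; length-drop; take-drop; take-take; drop-drop; map-upTo; length-upTo)
open import Data.List.Relation.Unary.All as All using (All; []; _∷_)
open import Data.List.Relation.Unary.All.Properties using (concat⁺; map⁺; tabulate⁺; applyUpTo⁺₁)
open import Data.List.Membership.Propositional.Properties using (∈-upTo⁺)
open import Data.Nat using (ℕ; zero; suc; _+_; _*_; _∸_; _^_; _⊓_; _≤_; _<_; _<ᵇ_; _≡ᵇ_; z≤n; s≤s; s≤s⁻¹)
open import Data.Nat.Properties
open import Data.Nat.Tactic.RingSolver using (solve-∀)
open import Data.Product using (Σ; _×_; _,_; proj₁; proj₂)
open import Data.Sum as Sum using (inj₁; inj₂)
open import Function using (_∘_; id)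
open import Function.Bundles using (Equivalence)
open import Relation.Binary.PropositionalEquality
  using (_≡_; _≢_; refl; sym; trans; cong; cong₂; subst; module ≡-Reasoning)
open import Relation.Nullary using (yes; no; ¬_)

-- Finite sums over lists.

private variable A B : Set

∑ : List A → (A → ℕ) → ℕ
∑ []       f = 0
∑ (x ∷ xs) f = f x + ∑ xs f

∑-++ : ∀ (xs ys : List A) f → ∑ (xs ++ ys) f ≡ ∑ xs f + ∑ ys f
∑-++ []       ys f = refl
∑-++ (x ∷ xs) ys f = trans (cong (f x +_) (∑-++ xs ys f)) (sym (+-assoc (f x) _ _))

∑-map : ∀ (h : B → A) (xs : List B) f → ∑ (map h xs) f ≡ ∑ xs (f ∘ h)
∑-map h []       f = refl
∑-map h (x ∷ xs) f = cong (f (h x) +_) (∑-map h xs f)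

∑-concatMap : ∀ (h : B → List A) (xs : List B) f →
  ∑ (concatMap h xs) f ≡ ∑ xs (λ x → ∑ (h x) f)
∑-concatMap h []       f = refl
∑-concatMap h (x ∷ xs) f =
  trans (∑-++ (h x) (concatMap h xs) f) (cong (∑ (h x) f +_) (∑-concatMap h xs f))

∑-cong : ∀ (xs : List A) {f g} → (∀ x → f x ≡ g x) → ∑ xs f ≡ ∑ xs g
∑-cong []       f≡g = refl
∑-cong (x ∷ xs) f≡g = cong₂ _+_ (f≡g x) (∑-cong xs f≡g)

∑-mono : ∀ {xs : List A} {f g} → All (λ x → f x ≤ g x) xs → ∑ xs f ≤ ∑ xs g
∑-mono []             = z≤n
∑-mono (fx≤gx ∷ rest) = +-mono-≤ fx≤gx (∑-mono rest)

∑-const : ∀ (xs : List A) c → ∑ xs (λ _ → c) ≡ length xs * c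
∑-const []       c = refl
∑-const (x ∷ xs) c = cong (c +_) (∑-const xs c)

∑-+ : ∀ (xs : List A) f g → ∑ xs (λ x → f x + g x) ≡ ∑ xs f + ∑ xs g
∑-+ []       f g = refl
∑-+ (x ∷ xs) f g = trans (cong (f x + g x +_) (∑-+ xs f g)) (shuffle (f x) (g x) _ _)
  where
  shuffle : ∀ a b c d → (a + b) + (c + d) ≡ (a + c) + (b + d)
  shuffle = solve-∀

∑-swap : ∀ (xs : List A) (ys : List B) (X : A → B → ℕ) →
  ∑ xs (λ x → ∑ ys (X x)) ≡ ∑ ys (λ y → ∑ xs (λ x → X x y))
∑-swap []       ys X = sym (trans (∑-const ys 0) (*-zeroʳ (length ys)))
∑-swap (x ∷ xs) ys X =
  trans (cong (∑ ys (X x) +_) (∑-swap xs ys X)) (sym (∑-+ ys (X x) _))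

applyUpTo-+ : ∀ (f : ℕ → A) a b → applyUpTo f (a + b) ≡ applyUpTo f a ++ applyUpTo (f ∘ (a +_)) b
applyUpTo-+ f zero    b = refl
applyUpTo-+ f (suc a) b = cong (f 0 ∷_) (applyUpTo-+ (f ∘ suc) a b)

∑-applyUpTo : ∀ (f : ℕ → A) n F → ∑ (applyUpTo f n) F ≡ ∑ (upTo n) (F ∘ f)
∑-applyUpTo f n F = trans (cong (λ xs → ∑ xs F) (sym (map-upTo f n))) (∑-map f (upTo n) F)

∑-upTo-+ : ∀ a b F → ∑ (upTo (a + b)) F ≡ ∑ (upTo a) F + ∑ (upTo b) (λ j → F (a + j))
∑-upTo-+ a b F = begin
  ∑ (upTo (a + b)) F                       ≡⟨ cong (λ xs → ∑ xs F) (applyUpTo-+ id a b) ⟩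
  ∑ (upTo a ++ applyUpTo (a +_) b) F       ≡⟨ ∑-++ (upTo a) _ F ⟩
  ∑ (upTo a) F + ∑ (applyUpTo (a +_) b) F  ≡⟨ cong (∑ (upTo a) F +_) (∑-applyUpTo (a +_) b F) ⟩
  ∑ (upTo a) F + ∑ (upTo b) (λ j → F (a + j)) ∎
  where open ≡-Reasoning

∑-upTo-mono : ∀ n {F G : ℕ → ℕ} → (∀ i → i < n → F i ≤ G i) → ∑ (upTo n) F ≤ ∑ (upTo n) G
∑-upTo-mono n F≤G = ∑-mono (applyUpTo⁺₁ id n (F≤G _))

indicator : Bool → ℕ
indicator true  = 1
indicator false = 0

indicator-mono : ∀ {b c} → (T b → T c) → indicator b ≤ indicator c
indicator-mono {false}         b⇒c = z≤n
indicator-mono {true}  {true}  b⇒c = ≤-refl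
indicator-mono {true}  {false} b⇒c = ⊥-elim (b⇒c _)

∑-below : ∀ N q → ∑ (upTo N) (λ i → indicator (i <ᵇ q)) ≤ q
∑-below zero    q       = z≤n
∑-below (suc N) zero    = ≤-trans (≤-reflexive (∑-applyUpTo suc N _)) (∑-below N zero)
∑-below (suc N) (suc q) = s≤s (≤-trans (≤-reflexive (∑-applyUpTo suc N _)) (∑-below N q))

-- If a position r < g is marked only when m + r ≤ p, and g + j only
-- when j ≤ p, then at most p + 1 positions are marked: the cyclic relabelling
-- r ↦ m + r, g + j ↦ j is injective and sends marked positions into {0, …, p}.
marked-bound : ∀ (b : ℕ → Bool) g m p →
  (∀ r → r < g → T (b r) → m + r ≤ p) →
  (∀ j → j < m → T (b (g + j)) → j ≤ p) →
  ∑ (upTo (g + m)) (indicator ∘ b) ≤ suc p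
marked-bound b g m p before after = begin
  ∑ (upTo (g + m)) marks                           ≡⟨ ∑-upTo-+ g m marks ⟩
  ∑ (upTo g) marks + ∑ (upTo m) (marks ∘ (g +_))  ≤⟨ +-mono-≤ (∑-upTo-mono g relabel-before)
                                                              (∑-upTo-mono m relabel-after) ⟩
  ∑ (upTo g) (I ∘ (m +_)) + ∑ (upTo m) I          ≡⟨ +-comm _ (∑ (upTo m) I) ⟩
  ∑ (upTo m) I + ∑ (upTo g) (I ∘ (m +_))          ≡⟨ ∑-upTo-+ m g I ⟨
  ∑ (upTo (m + g)) I                               ≤⟨ ∑-below (m + g) (suc p) ⟩
  suc p                                            ∎
  where
  open ≤-Reasoning
  marks I : ℕ → ℕ
  marks = indicator ∘ b
  I i = indicator (i <ᵇ suc p)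
  relabel-before : ∀ r → r < g → marks r ≤ I (m + r)
  relabel-before r r<g = indicator-mono (<⇒<ᵇ ∘ s≤s ∘ before r r<g)
  relabel-after : ∀ j → j < m → marks (g + j) ≤ I j
  relabel-after j j<m = indicator-mono (<⇒<ᵇ ∘ s≤s ∘ after j j<m)

letters : List Letter
letters = allFin 4

strings-cons : ∀ n f →
  ∑ (allStrings (suc n)) f ≡ ∑ letters (λ a → ∑ (allStrings n) (λ u → f (a ∷ u)))
strings-cons n f =
  trans (∑-concatMap (λ a → map (a ∷_) (allStrings n)) letters f)
        (∑-cong letters (λ a → ∑-map (a ∷_) (allStrings n) f))

-- Splitting off the last letter: induction on the length, moving the last
-- letter past the first one by exchanging the two sums over letters.
strings-snoc : ∀ n f →
  ∑ (allStrings (suc n)) f ≡ ∑ letters (λ a → ∑ (allStrings n) (λ u → f (u ∷ʳ a)))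
strings-snoc zero    f = strings-cons zero f
strings-snoc (suc n) f = begin
  ∑ (allStrings (suc (suc n))) f
    ≡⟨ strings-cons (suc n) f ⟩
  ∑ letters (λ b → ∑ (allStrings (suc n)) (λ u → f (b ∷ u)))
    ≡⟨ ∑-cong letters (λ b → strings-snoc n (λ u → f (b ∷ u))) ⟩
  ∑ letters (λ b → ∑ letters (λ a → ∑ (allStrings n) (λ u → f (b ∷ u ∷ʳ a))))
    ≡⟨ ∑-swap letters letters (λ b a → ∑ (allStrings n) (λ u → f (b ∷ u ∷ʳ a))) ⟩
  ∑ letters (λ a → ∑ letters (λ b → ∑ (allStrings n) (λ u → f (b ∷ u ∷ʳ a))))
    ≡⟨ ∑-cong letters (λ a → strings-cons n (λ u → f (u ∷ʳ a))) ⟨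
  ∑ letters (λ a → ∑ (allStrings (suc n)) (λ u → f (u ∷ʳ a))) ∎
  where open ≡-Reasoning

strings-length : ∀ n → All (λ u → length u ≡ n) (allStrings n)
strings-length zero    = refl ∷ []
strings-length (suc n) =
  concat⁺ (map⁺ (tabulate⁺ {f = id} (λ a → map⁺ {f = a ∷_} (All.map (cong suc) (strings-length n)))))

∑-strings-const : ∀ n c → ∑ (allStrings n) (λ _ → c) ≡ 4 ^ n * c
∑-strings-const zero    c = refl
∑-strings-const (suc n) c = begin
  ∑ (allStrings (suc n)) (λ _ → c)             ≡⟨ strings-cons n _ ⟩
  ∑ letters (λ _ → ∑ (allStrings n) (λ _ → c)) ≡⟨ ∑-cong letters (λ _ → ∑-strings-const n c) ⟩
  ∑ letters (λ _ → 4 ^ n * c)                  ≡⟨ ∑-const letters (4 ^ n * c) ⟩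
  4 * (4 ^ n * c)                              ≡⟨ *-assoc 4 (4 ^ n) c ⟨
  4 ^ suc n * c                                ∎
  where open ≡-Reasoning

count-as-∑ : ∀ (b : List Letter → Bool) xs → length (filter (λ t → T? (b t)) xs) ≡ ∑ xs (indicator ∘ b)
count-as-∑ b []       = refl
count-as-∑ b (x ∷ xs) with b x
... | true  = cong suc (count-as-∑ b xs)
... | false = count-as-∑ b xs

rot1 : List A → List A
rot1 []      = []
rot1 (a ∷ u) = u ∷ʳ a

rotate : ℕ → List A → List A
rotate zero    u = u
rotate (suc r) u = rotate r (rot1 u)

-- rot1 is a bijection of the strings of length n: a sum over all strings is
-- unchanged by precomposing with it (first-letter versus last-letter split).
rot1-invariant : ∀ n f → ∑ (allStrings n) (f ∘ rot1) ≡ ∑ (allStrings n) f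
rot1-invariant zero    f = refl
rot1-invariant (suc n) f = trans (strings-cons n (f ∘ rot1)) (sym (strings-snoc n f))

rotate-invariant : ∀ r n f → ∑ (allStrings n) (f ∘ rotate r) ≡ ∑ (allStrings n) f
rotate-invariant zero    n f = refl
rotate-invariant (suc r) n f = trans (rot1-invariant n (f ∘ rotate r)) (rotate-invariant r n f)

length-rotate : ∀ r (u : List A) → length (rotate r u) ≡ length u
length-rotate zero    u       = refl
length-rotate (suc r) []      = length-rotate r []
length-rotate (suc r) (a ∷ u) = trans (length-rotate r (u ∷ʳ a)) (trans (length-++ u) (+-comm _ 1))

-- Windows of strings.  `sub p t i` (from Defs) is the length-p window of t at
-- position i; the cyclic windows of u are the windows of u ++ u.

take-++ˡ : ∀ m (xs ys : List A) → m ≤ length xs → take m (xs ++ ys) ≡ take m xs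
take-++ˡ zero    xs       ys _        = refl
take-++ˡ (suc m) (x ∷ xs) ys (s≤s m≤) = cong (x ∷_) (take-++ˡ m xs ys m≤)

drop-++ˡ : ∀ m (xs ys : List A) → m ≤ length xs → drop m (xs ++ ys) ≡ drop m xs ++ ys
drop-++ˡ zero    xs       ys _        = refl
drop-++ˡ (suc m) (x ∷ xs) ys (s≤s m≤) = drop-++ˡ m xs ys m≤

take-length-++ : ∀ m (xs ys : List A) → take (length xs + m) (xs ++ ys) ≡ xs ++ take m ys
take-length-++ m []       ys = refl
take-length-++ m (x ∷ xs) ys = cong (x ∷_) (take-length-++ m xs ys)

drop-length-++ : ∀ m (xs ys : List A) → drop (length xs + m) (xs ++ ys) ≡ drop m ys
drop-length-++ m []       ys = refl
drop-length-++ m (x ∷ xs) ys = drop-length-++ m xs ys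

window-take : ∀ j p m (xs : List A) → j + p ≤ m → take p (drop j (take m xs)) ≡ take p (drop j xs)
window-take j p m xs j+p≤m = begin
  take p (drop j (take m xs))       ≡⟨ take-drop p j (take m xs) ⟩
  drop j (take (j + p) (take m xs)) ≡⟨ cong (drop j) (take-take (j + p) m xs) ⟩
  drop j (take ((j + p) ⊓ m) xs)    ≡⟨ cong (λ l → drop j (take l xs)) (m≤n⇒m⊓n≡m j+p≤m) ⟩
  drop j (take (j + p) xs)          ≡⟨ take-drop p j xs ⟨
  take p (drop j xs)                ∎
  where open ≡-Reasoning

length-sub : ∀ p (t : List Letter) i → i + p ≤ length t → length (sub p t i) ≡ p
length-sub p t i i+p≤ = begin
  length (take p (drop i t)) ≡⟨ length-take p (drop i t) ⟩
  p ⊓ length (drop i t)      ≡⟨ m≤n⇒m⊓n≡m (subst (p ≤_) (sym (length-drop i t)) p≤rest) ⟩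
  p                          ∎
  where
  open ≡-Reasoning
  p≤rest : p ≤ length t ∸ i
  p≤rest = m+n≤o⇒m≤o∸n p (subst (_≤ length t) (+-comm i p) i+p≤)

rotate-split : ∀ r (u : List A) → r ≤ length u → rotate r u ≡ drop r u ++ take r u
rotate-split zero    u       _        = sym (++-identityʳ u)
rotate-split (suc r) (a ∷ u) (s≤s r≤) = begin
  rotate r (u ∷ʳ a)                  ≡⟨ rotate-split r (u ∷ʳ a) (≤-trans r≤ (length-++-≤ˡ u)) ⟩
  drop r (u ∷ʳ a) ++ take r (u ∷ʳ a) ≡⟨ cong₂ _++_ (drop-++ˡ r u [ a ] r≤) (take-++ˡ r u [ a ] r≤) ⟩
  (drop r u ++ [ a ]) ++ take r u    ≡⟨ ++-assoc (drop r u) [ a ] (take r u) ⟩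
  drop r u ++ a ∷ take r u           ∎
  where open ≡-Reasoning

rotate-window : ∀ r (u : List A) → r ≤ length u → rotate r u ≡ take (length u) (drop r (u ++ u))
rotate-window r u r≤ = begin
  rotate r u                                   ≡⟨ rotate-split r u r≤ ⟩
  drop r u ++ take r u                         ≡⟨ take-length-++ r (drop r u) u ⟨
  take (length (drop r u) + r) (drop r u ++ u) ≡⟨ cong (λ l → take l (drop r u ++ u)) rest+r≡length ⟩
  take (length u) (drop r u ++ u)              ≡⟨ cong (take (length u)) (drop-++ˡ r u u r≤) ⟨
  take (length u) (drop r (u ++ u))            ∎
  where
  open ≡-Reasoning
  rest+r≡length : length (drop r u) + r ≡ length u
  rest+r≡length = trans (cong (_+ r) (length-drop r u)) (m∸n+n≡m r≤)

sub-rotate : ∀ p r j (u : List Letter) → r ≤ length u → j + p ≤ length u →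
  sub p (rotate r u) j ≡ sub p (u ++ u) (r + j)
sub-rotate p r j u r≤ j+p≤ = begin
  take p (drop j (rotate r u))                          ≡⟨ cong (take p ∘ drop j) (rotate-window r u r≤) ⟩
  take p (drop j (take (length u) (drop r (u ++ u))))   ≡⟨ window-take j p (length u) _ j+p≤ ⟩
  take p (drop j (drop r (u ++ u)))                     ≡⟨ cong (take p) (drop-drop r j (u ++ u)) ⟩
  take p (drop (r + j) (u ++ u))                        ∎
  where open ≡-Reasoning

sub-period : ∀ p s (u : List Letter) → s + p ≤ length u →
  sub p (u ++ u) (length u + s) ≡ sub p (u ++ u) s
sub-period p s u s+p≤ = begin
  take p (drop (length u + s) (u ++ u)) ≡⟨ cong (take p) (drop-length-++ s u u) ⟩
  take p (drop s u)                     ≡⟨ take-++ˡ p (drop s u) u p≤rest ⟨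
  take p (drop s u ++ u)                ≡⟨ cong (take p) (drop-++ˡ s u u (m+n≤o⇒m≤o s s+p≤)) ⟨
  take p (drop s (u ++ u))              ∎
  where
  open ≡-Reasoning
  p≤rest : p ≤ length (drop s u)
  p≤rest = subst (p ≤_) (sym (length-drop s u)) (m+n≤o⇒m≤o∸n p (subst (_≤ length u) (+-comm s p) s+p≤))

-- The numeric value of a string read in base 4.  On strings of equal length
-- it is strictly monotone for the lexicographic order, so the comparison of
-- windows can be carried out in ℕ, where minima exist.

val : List Letter → ℕ
val []      = 0
val (a ∷ u) = toℕ a * 4 ^ length u + val u

val-bound : ∀ u → val u < 4 ^ length u

val-head-bound : ∀ a u → val (a ∷ u) < suc (toℕ a) * 4 ^ length u
val-head-bound a u =
  <-≤-trans (+-monoʳ-< (toℕ a * 4 ^ length u) (val-bound u)) (≤-reflexive (+-comm _ (4 ^ length u)))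

val-bound []      = s≤s z≤n
val-bound (a ∷ u) = <-≤-trans (val-head-bound a u) (*-monoˡ-≤ (4 ^ length u) (toℕ<n a))

-- Lexicographic order implies strict order of values (equal lengths): the
-- first differing letter outweighs everything after it.
val-strict : ∀ a b → length a ≡ length b → T (a <lex b) → val a < val b
val-strict []      []      _  ()
val-strict []      (_ ∷ _) () _
val-strict (_ ∷ _) []      () _
val-strict (x ∷ a) (y ∷ b) same-length a<b with toℕ x <ᵇ toℕ y in x<y
... | true = begin-strict
  val (x ∷ a)                  <⟨ val-head-bound x a ⟩
  suc (toℕ x) * 4 ^ length a   ≤⟨ *-monoˡ-≤ (4 ^ length a) (<ᵇ⇒< (toℕ x) (toℕ y) (subst T (sym x<y) _)) ⟩
  toℕ y * 4 ^ length a         ≤⟨ m≤m+n _ (val b) ⟩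
  toℕ y * 4 ^ length a + val b ≡⟨ cong (λ l → toℕ y * 4 ^ l + val b) (suc-injective same-length) ⟩
  val (y ∷ b)                  ∎
  where open ≤-Reasoning
... | false with toℕ x ≡ᵇ toℕ y in x≡y
...   | true = begin-strict
  toℕ x * 4 ^ length a + val a <⟨ +-monoʳ-< _ (val-strict a b (suc-injective same-length) a<b) ⟩
  toℕ x * 4 ^ length a + val b ≡⟨ cong₂ (λ c l → c * 4 ^ l + val b)
                                        (≡ᵇ⇒≡ (toℕ x) (toℕ y) (subst T (sym x≡y) _))
                                        (suc-injective same-length) ⟩
  toℕ y * 4 ^ length b + val b ∎
  where open ≤-Reasoning

allB-sound : ∀ (h : A → Bool) xs → T (allB h xs) → All (T ∘ h) xs
allB-sound h []       _       = []
allB-sound h (x ∷ xs) hx∧rest = proj₁ both ∷ allB-sound h xs (proj₂ both)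
  where both = Equivalence.to T-∧ hx∧rest

unguard : ∀ j i {x} → j ≢ i → T (if j ≡ᵇ i then true else x) → T x
unguard j i j≢i h with j ≡ᵇ i in j≟i
... | true  = ⊥-elim (j≢i (≡ᵇ⇒≡ j i (subst T (sym j≟i) _)))
... | false = h

unique-min-below : ∀ n p t i j → T (isUniqueMinAt n p t i) → j ≤ n ∸ p → j ≢ i →
  T (sub p t i <lex sub p t j)
unique-min-below n p t i j unique j≤ j≢i =
  unguard j i j≢i (All.lookup (allB-sound _ _ unique) (∈-upTo⁺ (s≤s j≤)))

unique-min-val : ∀ k p t i j → length t ≡ suc k → i + p ≤ suc k → j + p ≤ suc k → j ≢ i →
  T (isUniqueMinAt (suc k) p t i) → val (sub p t i) < val (sub p t j)
unique-min-val k p t i j |t|≡n i+p≤n j+p≤n j≢i unique =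
  val-strict (sub p t i) (sub p t j) same-length (unique-min-below (suc k) p t i j unique (m+n≤o⇒m≤o∸n j j+p≤n) j≢i)
  where
  same-length : length (sub p t i) ≡ length (sub p t j)
  same-length = trans (length-sub p t i (subst (i + p ≤_) (sym |t|≡n) i+p≤n))
                      (sym (length-sub p t j (subst (j + p ≤_) (sym |t|≡n) j+p≤n)))

-- If some window strictly inside t (neither the first nor the last one) has
-- minimal value, the event fails: a unique minimal end window would have to
-- be strictly below it.
interior-min-excludes-event : ∀ k p t j → length t ≡ suc k → 0 < j → j + p < suc k →
  (∀ i → i + p ≤ suc k → val (sub p t j) ≤ val (sub p t i)) → ¬ T (event k p t)
interior-min-excludes-event k p t j |t|≡n 0<j j+p<n j-minimal ev =
  Sum.[ excluded 0 p≤n (>⇒≢ 0<j) , excluded (suc k ∸ p) (≤-reflexive (m∸n+n≡m p≤n)) (<⇒≢ j<n∸p) ]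
    (Equivalence.to T-∨ ev)
  where
  p≤n : p ≤ suc k
  p≤n = m+n≤o⇒n≤o j (<⇒≤ j+p<n)
  j<n∸p : j < suc k ∸ p
  j<n∸p = m+n≤o⇒m≤o∸n (suc j) j+p<n
  excluded : ∀ i → i + p ≤ suc k → j ≢ i → ¬ T (isUniqueMinAt (suc k) p t i)
  excluded i i+p≤n j≢i unique =
    <⇒≱ (unique-min-val k p t i j |t|≡n i+p≤n (<⇒≤ j+p<n) j≢i unique) (j-minimal i i+p≤n)

argmin : (w : ℕ → ℕ) (n : ℕ) → Σ ℕ λ g → g ≤ n × (∀ i → i ≤ n → w g ≤ w i)
argmin w zero = zero , z≤n , λ { zero z≤n → ≤-refl }
argmin w (suc n) with argmin w n
... | g , g≤n , g-min with ≤-total (w g) (w (suc n))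
...   | inj₁ wg≤wn = g , m≤n⇒m≤1+n g≤n , minimal
  where
  minimal : ∀ i → i ≤ suc n → w g ≤ w i
  minimal i i≤ with m≤n⇒m<n∨m≡n i≤
  ... | inj₁ i<n   = g-min i (s≤s⁻¹ i<n)
  ... | inj₂ refl  = wg≤wn
...   | inj₂ wn≤wg = suc n , ≤-refl , minimal
  where
  minimal : ∀ i → i ≤ suc n → w (suc n) ≤ w i
  minimal i i≤ with m≤n⇒m<n∨m≡n i≤
  ... | inj₁ i<n   = ≤-trans wn≤wg (g-min i (s≤s⁻¹ i<n))
  ... | inj₂ refl  = ≤-refl

module Orbit (k p : ℕ) (1≤p : 1 ≤ p) (u : List Letter) (|u|≡n : length u ≡ suc k) where

  n : ℕ
  n = suc k

  cyc : ℕ → List Letter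
  cyc t = sub p (u ++ u) t

  weight : ℕ → ℕ
  weight t = val (cyc t)

  g : ℕ
  g = proj₁ (argmin weight k)

  g<n : g < n
  g<n = s≤s (proj₁ (proj₂ (argmin weight k)))

  g-min : ∀ t → t ≤ k → weight g ≤ weight t
  g-min = proj₂ (proj₂ (argmin weight k))

  m : ℕ
  m = n ∸ g

  g+m≡n : g + m ≡ n
  g+m≡n = m+[n∸m]≡n (<⇒≤ g<n)

  cyc-period : ∀ s → s + p ≤ n → cyc (n + s) ≡ cyc s
  cyc-period s s+p≤n =
    subst (λ l → cyc (l + s) ≡ cyc s) |u|≡n (sub-period p s u (subst (s + p ≤_) (sym |u|≡n) s+p≤n))

  -- By periodicity (and p ≥ 1) the window at g is minimal among all windows of u ++ u.
  weight-min : ∀ t → t + p ≤ n + n → weight g ≤ weight t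
  weight-min t t+p≤2n with t ≤? k
  ... | yes t≤k = g-min t t≤k
  ... | no  t≰k = begin
    weight g       ≤⟨ g-min s s≤k ⟩
    weight s       ≡⟨ cong val (cyc-period s s+p≤n) ⟨
    weight (n + s) ≡⟨ cong weight n+s≡t ⟩
    weight t       ∎
    where
    open ≤-Reasoning
    s : ℕ
    s = t ∸ n
    n+s≡t : n + s ≡ t
    n+s≡t = m+[n∸m]≡n (≰⇒> t≰k)
    s+p≤n : s + p ≤ n
    s+p≤n = +-cancelˡ-≤ n (s + p) n
              (subst (_≤ n + n) (trans (cong (_+ p) (sym n+s≡t)) (+-assoc n s p)) t+p≤2n)
    s≤k : s ≤ k
    s≤k = s≤s⁻¹ (≤-trans (subst (_≤ s + p) (+-comm s 1) (+-monoʳ-≤ s 1≤p)) s+p≤n)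

  sub-rotation : ∀ r j → r < n → j + p ≤ n → sub p (rotate r u) j ≡ cyc (r + j)
  sub-rotation r j r<n j+p≤n =
    sub-rotate p r j u (subst (r ≤_) (sym |u|≡n) (<⇒≤ r<n)) (subst (j + p ≤_) (sym |u|≡n) j+p≤n)

  offset-excluded : ∀ r o → r < n → 0 < o → o + p < n → cyc (r + o) ≡ cyc g →
    ¬ T (event k p (rotate r u))
  offset-excluded r o r<n 0<o o+p<n at-min =
    interior-min-excludes-event k p (rotate r u) o (trans (length-rotate r u) |u|≡n) 0<o o+p<n o-minimal
    where
    o-minimal : ∀ i → i + p ≤ n → val (sub p (rotate r u) o) ≤ val (sub p (rotate r u) i)
    o-minimal i i+p≤n = begin
      val (sub p (rotate r u) o) ≡⟨ cong val (sub-rotation r o r<n (<⇒≤ o+p<n)) ⟩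
      weight (r + o)             ≡⟨ cong val at-min ⟩
      weight g                   ≤⟨ weight-min (r + i) (subst (_≤ n + n) (sym (+-assoc r i p))
                                                         (+-mono-≤ (<⇒≤ r<n) i+p≤n)) ⟩
      weight (r + i)             ≡⟨ cong val (sub-rotation r i r<n i+p≤n) ⟨
      val (sub p (rotate r u) i) ∎
      where open ≤-Reasoning

  -- Rotation by r < g puts the minimal window at the nonzero offset g − r,
  -- which therefore has to be one of the last p positions.
  before-min : ∀ r → r < g → T (event k p (rotate r u)) → m + r ≤ p
  before-min r r<g ev = ≮⇒≥ λ p<m+r →
    offset-excluded r o (<-trans r<g g<n) (m<n⇒0<n∸m r<g) (o+p<n p<m+r) (cong cyc r+o≡g) ev
    where
    o : ℕ
    o = g ∸ r
    r+o≡g : r + o ≡ g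
    r+o≡g = m+[n∸m]≡n (<⇒≤ r<g)
    rearrange : ∀ a b c → a + (b + c) ≡ (c + a) + b
    rearrange = solve-∀
    o+p<n : p < m + r → o + p < n
    o+p<n p<m+r = begin-strict
      o + p       <⟨ +-monoʳ-< o p<m+r ⟩
      o + (m + r) ≡⟨ rearrange o m r ⟩
      (r + o) + m ≡⟨ cong (_+ m) r+o≡g ⟩
      g + m       ≡⟨ g+m≡n ⟩
      n           ∎
      where open ≤-Reasoning

  -- Rotation by g + j with j < m puts the minimal window, as the cyclic window
  -- at n + g, at offset n − j; this is among the last p positions iff j ≤ p.
  after-min : ∀ j → j < m → T (event k p (rotate (g + j) u)) → j ≤ p
  after-min j j<m ev = ≮⇒≥ λ p<j →
    offset-excluded (g + j) o r<n 0<o (o+p<n p<j) (at-min p<j) ev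
    where
    o : ℕ
    o = (m ∸ j) + g
    r<n : g + j < n
    r<n = subst (g + j <_) g+m≡n (+-monoʳ-< g j<m)
    0<o : 0 < o
    0<o = <-≤-trans (m<n⇒0<n∸m j<m) (m≤m+n (m ∸ j) g)
    rearrange₁ : ∀ a b c → (a + b) + c ≡ b + (c + a)
    rearrange₁ = solve-∀
    rearrange₂ : ∀ a b c → (a + b) + c ≡ (c + b) + a
    rearrange₂ = solve-∀
    o+j≡n : o + j ≡ n
    o+j≡n = trans (rearrange₁ (m ∸ j) g j) (trans (cong (g +_) (m+[n∸m]≡n (<⇒≤ j<m))) g+m≡n)
    o+p<n : p < j → o + p < n
    o+p<n p<j = subst (o + p <_) o+j≡n (+-monoʳ-< o p<j)
    at-min : p < j → cyc ((g + j) + o) ≡ cyc g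
    at-min p<j = trans (cong cyc (trans (rearrange₂ g j o) (cong (_+ g) o+j≡n)))
                       (cyc-period g (subst (g + p ≤_) g+m≡n (+-monoʳ-≤ g (<⇒≤ (<-trans p<j j<m)))))

  orbit-bound : ∑ (upTo n) (λ r → indicator (event k p (rotate r u))) ≤ suc p
  orbit-bound = subst (λ l → ∑ (upTo l) (λ r → indicator (event k p (rotate r u))) ≤ suc p) g+m≡n
                  (marked-bound (λ r → event k p (rotate r u)) g m p before-min after-min)

-- Double counting: summing the event over all strings and all their rotations
-- counts every satisfying string n times, while every rotation orbit
-- contributes at most p + 1.
theorem3p3 : (k p : ℕ) → 1 ≤ p → p ≤ k →
    count k p * (k + 1) ≤ (p + 1) * 4 ^ (k + 1)
theorem3p3 k p 1≤p _ = begin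
  count k p * (k + 1)                         ≡⟨ cong₂ _*_ (count-as-∑ (event k p) strings) (+-comm k 1) ⟩
  c * n                                       ≡⟨ *-comm c n ⟩
  n * c                                       ≡⟨ trans (∑-const (upTo n) c) (cong (_* c) (length-upTo n)) ⟨
  ∑ (upTo n) (λ _ → c)                        ≡⟨ ∑-cong (upTo n) (λ r → rotate-invariant r n E) ⟨
  ∑ (upTo n) (λ r → ∑ strings (E ∘ rotate r)) ≡⟨ ∑-swap (upTo n) strings (λ r u → E (rotate r u)) ⟩
  ∑ strings (λ u → ∑ (upTo n) (λ r → E (rotate r u)))
    ≤⟨ ∑-mono (All.map (λ {u} |u|≡n → Orbit.orbit-bound k p 1≤p u |u|≡n) (strings-length n)) ⟩
  ∑ strings (λ _ → suc p)                     ≡⟨ ∑-strings-const n (suc p) ⟩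
  4 ^ n * suc p                               ≡⟨ *-comm (4 ^ n) (suc p) ⟩
  suc p * 4 ^ n                               ≡⟨ cong₂ (λ a b → a * 4 ^ b) (+-comm 1 p) (+-comm 1 k) ⟩
  (p + 1) * 4 ^ (k + 1)                       ∎
  where
  open ≤-Reasoning
  n : ℕ
  n = suc k
  strings : List (List Letter)
  strings = allStrings n
  E : List Letter → ℕ
  E = indicator ∘ event k p
  c : ℕ
  c = ∑ strings E
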